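{- For every positive integer $k$, the windmill of $k$ wheels $W_4^{(k)}$ is difference distance magic orientable.
   Context: For $k\in\mathbb{Z}^+$, $W_4^{(k)}$ is the simple graph on $1+4k$ vertices with vertex set $\{v\}\cup\{v_{ij}: 1\le i\le k, 1\le j\le 4\}$ and edge set $\bigcup_{i=1}^k \{v_{i1}v_{i2}, v_{i1}v_{i3}, v_{i3}v_{i4}, v_{i2}v_{i4}, vv_{i1}, vv_{i2}, vv_{i3}, vv_{i4}\}$ (so $W_4^{(1)}$ is the wheel $W_4$). An orientation of a graph assigns a direction to each edge. For an oriented graph, $N^+(x)$ is the set of $y$ with $(y,x)$ an arc and $N^-(x)$ the set of $y$ with $(x,y)$ an arc; for a labeling $f$, $wt_f(x)=\sum_{y\in N^+(x)} f(y)-\sum_{y\in N^-(x)} f(y)$. A graph on $n$ vertices is difference distance magic orientable if it has an orientation admitting a bijection $f:V\to\{1,\dots,n\}$ with $wt_f(x)=0$ for every vertex $x$. -}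

module Defs where

open import Data.Nat using (ℕ; suc; _+_; _*_)
open import Data.Fin using (Fin; toℕ; zero; suc)
open import Data.Fin.Properties using () renaming (_≟_ to _≟ᶠ_)
open import Data.Integer using (ℤ; +_; 0ℤ) renaming (_+_ to _+ℤ_; _-_ to _-ℤ_)
open import Data.List using (List; []; _∷_; concatMap; allFin)
open import Data.List.Relation.Binary.Pointwise using (Pointwise)
open import Data.Maybe using (Maybe; nothing; just)
import Data.Maybe.Properties as MaybeP
import Data.Product.Properties as ProdP
open import Data.Product using (_×_; _,_; Σ; proj₁; proj₂)
open import Data.Sum using (_⊎_)
open import Function.Bundles using (_⤖_; Bijection)
open import Relation.Binary.Definitions using (DecidableEquality)
open import Relation.Binary.PropositionalEquality using (_≡_)
open import Relation.Nullary using (yes; no)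

-- Generic notions: a simple graph is given by a vertex type with
-- decidable equality and a list of (unordered) edges, each listed once
-- as an ordered pair {a,b} = (a , b).

swap : ∀ {V : Set} → V × V → V × V
swap (a , b) = (b , a)

-- An orientation of the edge list E is a list of arcs A, where the arc
-- at position p is either the edge at position p or its reversal.
-- An arc (t , h) is directed from t to h.
IsOrientation : ∀ {V : Set} → List (V × V) → List (V × V) → Set
IsOrientation E A = Pointwise (λ e a → a ≡ e ⊎ a ≡ swap e) E A

wt : ∀ {V : Set} → DecidableEquality V → List (V × V) → (V → ℕ) → V → ℤ
wt _≟_ [] f x = 0ℤ
wt _≟_ ((t , h) ∷ A) f x = inContrib +ℤ outContrib +ℤ wt _≟_ A f x
  where
  inContrib : ℤ
  inContrib with h ≟ x
  ... | yes _ = + f t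
  ... | no  _ = 0ℤ
  outContrib : ℤ
  outContrib with t ≟ x
  ... | yes _ = 0ℤ -ℤ + f h
  ... | no  _ = 0ℤ

-- A graph on n vertices (V with V ⤖ Fin n) is difference distance magic
-- orientable if some orientation admits a bijection f : V → {1,…,n}
-- (given as g : V ⤖ Fin n with f x = toℕ (g x) + 1) with wt_f(x) = 0
-- for every vertex x.
DDMOrientable : (V : Set) → DecidableEquality V → (n : ℕ) → List (V × V) → Set
DDMOrientable V _≟_ n E =
  Σ (List (V × V)) λ A → IsOrientation E A ×
  Σ (V ⤖ Fin n) λ g →
    let f : V → ℕ
        f x = suc (toℕ (Bijection.to g x))
    in (x : V) → wt _≟_ A f x ≡ 0ℤ

-- The windmill W₄^(k).  Vertex  nothing  is the centre v, and
-- just (i , j) is v_{i,j+1} (i ∈ Fin k, j ∈ Fin 4, so j = 0,1,2,3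
-- stands for the paper's j = 1,2,3,4).

WVertex : ℕ → Set
WVertex k = Maybe (Fin k × Fin 4)

_≟W_ : ∀ {k} → DecidableEquality (WVertex k)
_≟W_ = MaybeP.≡-dec (ProdP.≡-dec _≟ᶠ_ _≟ᶠ_)

v1 v2 v3 v4 : ∀ {k} → Fin k → WVertex k
v1 i = just (i , zero)
v2 i = just (i , suc zero)
v3 i = just (i , suc (suc zero))
v4 i = just (i , suc (suc (suc zero)))

centre : ∀ {k} → WVertex k
centre = nothing

wheelEdges : ∀ {k} → Fin k → List (WVertex k × WVertex k)
wheelEdges i =
  (v1 i , v2 i) ∷ (v1 i , v3 i) ∷ (v3 i , v4 i) ∷ (v2 i , v4 i) ∷
  (centre , v1 i) ∷ (centre , v2 i) ∷ (centre , v3 i) ∷ (centre , v4 i) ∷ []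

windmillEdges : (k : ℕ) → List (WVertex k × WVertex k)
windmillEdges k = concatMap wheelEdges (allFin k)

-- Each wheel is oriented as the 4-cycle a → b → d → c → a together with
-- the spokes a → v → b and c → v → d.  With this orientation every vertex
-- of the wheel has weight zero as soon as the labels satisfy
-- f c = f b + f v and f d = f a + f v.  Giving the centre the label 1 and
-- wheel i the labels 4i+2, …, 4i+5, with the opposite pairs {v₁, v₄} and
-- {v₂, v₃} of the 4-cycle on consecutive labels, satisfies these equations
-- in every wheel at once, and weights add up over the wheels.
module Submission where

open import Data.Fin using (Fin; toℕ; cast; combine; remQuot; zero; suc)
open import Data.Fin.Patterns using (0F; 1F; 2F; 3F)
open import Data.Fin.Properties
  using (toℕ-cast; toℕ-combine; cast-involutive; remQuot-combine; combine-remQuot)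
open import Data.Integer using (ℤ; +_; 0ℤ; 1ℤ)
  renaming (_+_ to _+ℤ_; _-_ to _-ℤ_; _*_ to _*ℤ_)
open import Data.Integer.Properties using (+-assoc; +-identityˡ; *-identityˡ)
open import Data.Integer.Tactic.RingSolver using (solve-∀)
open import Data.List using (List; []; _∷_; _++_; concatMap; allFin)
open import Data.List.Relation.Binary.Pointwise as Pointwise using (++⁺)
open import Data.Maybe using (nothing; just)
open import Data.Nat using (ℕ; suc; _+_; _*_; _≤_)
open import Data.Nat.Properties using (*-comm; +-suc; +-comm)
open import Data.Product using (_×_; _,_; proj₁; proj₂; map₂; uncurry)
open import Data.Sum using (inj₁; inj₂)
open import Function.Base using (_∘_)
open import Function.Bundles using (_⤖_; mk↔ₛ′)
open import Function.Properties.Inverse using (↔⇒⤖)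
open import Relation.Binary.Definitions using (DecidableEquality)
open import Relation.Binary.PropositionalEquality
open import Relation.Nullary using (Dec; yes; no)

open import Defs

indicator : ∀ {P : Set} → Dec P → ℤ
indicator (yes _) = 1ℤ
indicator (no _)  = 0ℤ

-- wt with its case distinctions replaced by 0/1 indicators, which makes
-- the weight a polynomial in the labels and the indicators.
wtℤ : ∀ {V : Set} → DecidableEquality V → List (V × V) → (V → ℤ) → V → ℤ
wtℤ _≟_ []            F x = 0ℤ
wtℤ _≟_ ((t , h) ∷ A) F x =
  indicator (h ≟ x) *ℤ F t +ℤ (0ℤ -ℤ indicator (t ≟ x) *ℤ F h) +ℤ wtℤ _≟_ A F x

wtℤ≡wt : ∀ {V : Set} (_≟_ : DecidableEquality V) A (f : V → ℕ) x →
         wtℤ _≟_ A (λ y → + f y) x ≡ wt _≟_ A f x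
wtℤ≡wt _≟_ []            f x = refl
wtℤ≡wt _≟_ ((t , h) ∷ A) f x with h ≟ x | t ≟ x
... | yes _ | yes _ = cong₂ _+ℤ_ (cong₂ _+ℤ_ (*-identityˡ (+ f t))
                                            (cong (0ℤ -ℤ_) (*-identityˡ (+ f h))))
                              (wtℤ≡wt _≟_ A f x)
... | yes _ | no _  = cong₂ _+ℤ_ (cong (_+ℤ 0ℤ) (*-identityˡ (+ f t))) (wtℤ≡wt _≟_ A f x)
... | no _  | yes _ = cong₂ _+ℤ_ (cong (λ o → 0ℤ +ℤ (0ℤ -ℤ o)) (*-identityˡ (+ f h)))
                              (wtℤ≡wt _≟_ A f x)
... | no _  | no _  = cong (0ℤ +ℤ_) (wtℤ≡wt _≟_ A f x)

wtℤ-++ : ∀ {V : Set} (_≟_ : DecidableEquality V) A B F x →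
         wtℤ _≟_ (A ++ B) F x ≡ wtℤ _≟_ A F x +ℤ wtℤ _≟_ B F x
wtℤ-++ _≟_ []            B F x = sym (+-identityˡ _)
wtℤ-++ _≟_ ((t , h) ∷ A) B F x = begin
  arc +ℤ wtℤ _≟_ (A ++ B) F x                 ≡⟨ cong (arc +ℤ_) (wtℤ-++ _≟_ A B F x) ⟩
  arc +ℤ (wtℤ _≟_ A F x +ℤ wtℤ _≟_ B F x)     ≡⟨ +-assoc arc _ _ ⟨
  arc +ℤ wtℤ _≟_ A F x +ℤ wtℤ _≟_ B F x       ∎
  where
  open ≡-Reasoning
  arc : ℤ
  arc = indicator (h ≟ x) *ℤ F t +ℤ (0ℤ -ℤ indicator (t ≟ x) *ℤ F h)

wtℤ-concatMap≡0 : ∀ {V I : Set} (_≟_ : DecidableEquality V) (B : I → List (V × V)) F →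
                  (∀ i x → wtℤ _≟_ (B i) F x ≡ 0ℤ) →
                  ∀ is x → wtℤ _≟_ (concatMap B is) F x ≡ 0ℤ
wtℤ-concatMap≡0 _≟_ B F balanced []       x = refl
wtℤ-concatMap≡0 _≟_ B F balanced (i ∷ is) x = begin
  wtℤ _≟_ (B i ++ concatMap B is) F x                 ≡⟨ wtℤ-++ _≟_ (B i) _ F x ⟩
  wtℤ _≟_ (B i) F x +ℤ wtℤ _≟_ (concatMap B is) F x
    ≡⟨ cong₂ _+ℤ_ (balanced i x) (wtℤ-concatMap≡0 _≟_ B F balanced is x) ⟩
  0ℤ                                                  ∎
  where open ≡-Reasoning

IsOrientation-concatMap : ∀ {V I : Set} {E A : I → List (V × V)} →
                          (∀ i → IsOrientation (E i) (A i)) →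
                          ∀ is → IsOrientation (concatMap E is) (concatMap A is)
IsOrientation-concatMap orients []       = Pointwise.[]
IsOrientation-concatMap orients (i ∷ is) = ++⁺ (orients i) (IsOrientation-concatMap orients is)

wheelArcs : ∀ {V : Set} → V → V → V → V → V → List (V × V)
wheelArcs a b c d v =
  (a , b) ∷ (c , a) ∷ (d , c) ∷ (b , d) ∷ (a , v) ∷ (v , b) ∷ (c , v) ∷ (v , d) ∷ []

wtℤ-wheelArcs≡0 : ∀ {V : Set} (_≟_ : DecidableEquality V) (F : V → ℤ) a b c d v →
                  F c ≡ F b +ℤ F v → F d ≡ F a +ℤ F v →
                  ∀ x → wtℤ _≟_ (wheelArcs a b c d v) F x ≡ 0ℤ
wtℤ-wheelArcs≡0 _≟_ F a b c d v Fc≡Fb+Fv Fd≡Fa+Fv x rewrite Fc≡Fb+Fv | Fd≡Fa+Fv =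
  balanced (indicator (a ≟ x)) (indicator (b ≟ x)) (indicator (c ≟ x)) (indicator (d ≟ x))
           (indicator (v ≟ x)) (F a) (F b) (F v)
  where
  -- α, β, γ, ε, ν stand for the indicators of x = a, b, c, d, v.
  balanced : ∀ α β γ ε ν p q r →
    β *ℤ p +ℤ (0ℤ -ℤ α *ℤ q) +ℤ
    (α *ℤ (q +ℤ r) +ℤ (0ℤ -ℤ γ *ℤ p) +ℤ
    (γ *ℤ (p +ℤ r) +ℤ (0ℤ -ℤ ε *ℤ (q +ℤ r)) +ℤ
    (ε *ℤ q +ℤ (0ℤ -ℤ β *ℤ (p +ℤ r)) +ℤ
    (ν *ℤ p +ℤ (0ℤ -ℤ α *ℤ r) +ℤ
    (β *ℤ r +ℤ (0ℤ -ℤ ν *ℤ q) +ℤ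
    (ν *ℤ (q +ℤ r) +ℤ (0ℤ -ℤ γ *ℤ r) +ℤ
    (ε *ℤ r +ℤ (0ℤ -ℤ ν *ℤ (p +ℤ r)) +ℤ 0ℤ))))))) ≡ 0ℤ
  balanced = solve-∀

wheelEdges-orientedBy-wheelArcs : ∀ {k} (i : Fin k) →
  IsOrientation (wheelEdges i) (wheelArcs (v1 i) (v2 i) (v3 i) (v4 i) centre)
wheelEdges-orientedBy-wheelArcs i =
  inj₁ refl ∷ inj₂ refl ∷ inj₂ refl ∷ inj₁ refl ∷ inj₂ refl ∷ inj₁ refl ∷ inj₂ refl ∷ inj₁ refl ∷ []
  where open Pointwise using ([]; _∷_)

windmillArcs : (k : ℕ) → List (WVertex k × WVertex k)
windmillArcs k = concatMap (λ i → wheelArcs (v1 i) (v2 i) (v3 i) (v4 i) centre) (allFin k)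

-- The position of a vertex among the labels of its wheel: v₁, v₄, v₂, v₃.
slot : Fin 4 → Fin 4
slot 0F = 0F
slot 1F = 2F
slot 2F = 3F
slot 3F = 1F

slot⁻¹ : Fin 4 → Fin 4
slot⁻¹ 0F = 0F
slot⁻¹ 1F = 3F
slot⁻¹ 2F = 1F
slot⁻¹ 3F = 2F

slot∘slot⁻¹ : ∀ j → slot (slot⁻¹ j) ≡ j
slot∘slot⁻¹ 0F = refl
slot∘slot⁻¹ 1F = refl
slot∘slot⁻¹ 2F = refl
slot∘slot⁻¹ 3F = refl

slot⁻¹∘slot : ∀ j → slot⁻¹ (slot j) ≡ j
slot⁻¹∘slot 0F = refl
slot⁻¹∘slot 1F = refl
slot⁻¹∘slot 2F = refl
slot⁻¹∘slot 3F = refl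

module _ (k : ℕ) where

  toLabelIndex : WVertex k → Fin (1 + 4 * k)
  toLabelIndex nothing        = zero
  toLabelIndex (just (i , j)) = suc (cast (*-comm k 4) (combine i (slot j)))

  fromLabelIndex : Fin (1 + 4 * k) → WVertex k
  fromLabelIndex zero    = nothing
  fromLabelIndex (suc n) = just (map₂ slot⁻¹ (remQuot {k} 4 (cast (*-comm 4 k) n)))

  toLabelIndex∘fromLabelIndex : ∀ n → toLabelIndex (fromLabelIndex n) ≡ n
  toLabelIndex∘fromLabelIndex zero    = refl
  toLabelIndex∘fromLabelIndex (suc n) = cong suc (begin
    cast (*-comm k 4) (combine (proj₁ r) (slot (slot⁻¹ (proj₂ r))))
      ≡⟨ cong (cast (*-comm k 4) ∘ combine (proj₁ r)) (slot∘slot⁻¹ (proj₂ r)) ⟩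
    cast (*-comm k 4) (uncurry combine r)
      ≡⟨ cong (cast (*-comm k 4)) (combine-remQuot {k} 4 _) ⟩
    cast (*-comm k 4) (cast (*-comm 4 k) n)
      ≡⟨ cast-involutive (*-comm k 4) (*-comm 4 k) n ⟩
    n ∎)
    where
    open ≡-Reasoning
    r = remQuot {k} 4 (cast (*-comm 4 k) n)

  fromLabelIndex∘toLabelIndex : ∀ x → fromLabelIndex (toLabelIndex x) ≡ x
  fromLabelIndex∘toLabelIndex nothing        = refl
  fromLabelIndex∘toLabelIndex (just (i , j)) = begin
    just (map₂ slot⁻¹ (remQuot {k} 4 (cast (*-comm 4 k) (cast (*-comm k 4) (combine i (slot j))))))
      ≡⟨ cong (λ n → just (map₂ slot⁻¹ (remQuot {k} 4 n)))
              (cast-involutive (*-comm 4 k) (*-comm k 4) _) ⟩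
    just (map₂ slot⁻¹ (remQuot {k} 4 (combine i (slot j))))
      ≡⟨ cong (just ∘ map₂ slot⁻¹) (remQuot-combine i (slot j)) ⟩
    just (i , slot⁻¹ (slot j))
      ≡⟨ cong (λ j′ → just (i , j′)) (slot⁻¹∘slot j) ⟩
    just (i , j) ∎
    where open ≡-Reasoning

  labelling : WVertex k ⤖ Fin (1 + 4 * k)
  labelling = ↔⇒⤖ (mk↔ₛ′ toLabelIndex fromLabelIndex
                         toLabelIndex∘fromLabelIndex fromLabelIndex∘toLabelIndex)

  label : WVertex k → ℕ
  label x = suc (toℕ (toLabelIndex x))

  label-consecutive : ∀ i j j′ → toℕ (slot j′) ≡ suc (toℕ (slot j)) →
                      label (just (i , j′)) ≡ label (just (i , j)) + 1
  label-consecutive i j j′ slot-suc = begin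
    label (just (i , j′))           ≡⟨ cong (λ n → 2 + n) (toℕ-block j′) ⟩
    2 + (4 * toℕ i + toℕ (slot j′)) ≡⟨ cong (λ s → 2 + (4 * toℕ i + s)) slot-suc ⟩
    2 + (4 * toℕ i + suc s)         ≡⟨ cong (λ n → 2 + n) (+-suc (4 * toℕ i) s) ⟩
    1 + (2 + (4 * toℕ i + s))       ≡⟨ +-comm 1 _ ⟩
    2 + (4 * toℕ i + s) + 1         ≡⟨ cong (λ n → 2 + n + 1) (toℕ-block j) ⟨
    label (just (i , j)) + 1        ∎
    where
    open ≡-Reasoning
    s = toℕ (slot j)
    toℕ-block : ∀ j → toℕ (cast (*-comm k 4) (combine i (slot j))) ≡ 4 * toℕ i + toℕ (slot j)
    toℕ-block j = trans (toℕ-cast _ _) (toℕ-combine i (slot j))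

theorem4 : (k : ℕ) → 1 ≤ k → DDMOrientable (WVertex k) _≟W_ (1 + 4 * k) (windmillEdges k)
theorem4 k _ =
  windmillArcs k ,
  IsOrientation-concatMap wheelEdges-orientedBy-wheelArcs (allFin k) ,
  labelling k ,
  λ x → trans (sym (wtℤ≡wt _≟W_ (windmillArcs k) (label k) x))
              (wtℤ-concatMap≡0 _≟W_ _ F wheel-balanced (allFin k) x)
  where
  F : WVertex k → ℤ
  F x = + label k x
  wheel-balanced : ∀ i x → wtℤ _≟W_ (wheelArcs (v1 i) (v2 i) (v3 i) (v4 i) centre) F x ≡ 0ℤ
  wheel-balanced i = wtℤ-wheelArcs≡0 _≟W_ F (v1 i) (v2 i) (v3 i) (v4 i) centre
    (cong +_ (label-consecutive k i 1F 2F refl))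
    (cong +_ (label-consecutive k i 0F 3F refl))
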